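{- Let $n\ge 3$ be odd and let $S,T,U\subseteq\mathbb Z_{2n}\setminus\{0\}$ be symmetric subsets with $A(\mathbb Z_{2n};U)=A(\mathbb Z_{2n};S)A(\mathbb Z_{2n};T)$. Put $\widehat S=\mathcal P(S)$, $\widehat T=\mathcal P(T)$, $\widehat U=\mathcal P(U)$. Then: (1) $\widehat S,\widehat T,\widehat U\subseteq D_{2n}\setminus\{e\}$ are symmetric and $A(D_{2n};\widehat U)=A(D_{2n};\widehat S)A(D_{2n};\widehat T)$; (2) each of $\widehat S,\widehat T,\widehat U$ is strongly symmetric. Moreover, if $A,B,C\subseteq\mathbb Z_{2n}\setminus\{0\}$ are symmetric with $A(\mathbb Z_{2n};C)=A(\mathbb Z_{2n};A)A(\mathbb Z_{2n};B)$ and there is an automorphism $\alpha$ of $\mathbb Z_{2n}$ with $(A,B,C)=(\alpha(S),\alpha(T),\alpha(U))$, then there is an automorphism $f$ of $D_{2n}$ with $(\mathcal P(A),\mathcal P(B),\mathcal P(C))=(f(\widehat S),f(\widehat T),f(\widehat U))$.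
   Context: $D_{2n}=\langle r,s\mid r^n=e,\ s^2=e,\ srs=r^{ -1}\rangle$. A subset $X$ of a group is symmetric if $X^{ -1}=X$ (for $\mathbb Z_{2n}$: $-X=X$). For a finite group $H$ with fixed enumeration $\{h_1,\dots,h_m\}$ and $X\subseteq H$, $A(H;X)$ is the $m\times m$ matrix with $(i,j)$ entry $1$ if $h_i^{ -1}h_j\in X$ and $0$ otherwise. Let $\varphi\colon\mathbb Z_{2n}\to\mathbb Z_2\times\mathbb Z_n$, $x\mapsto(x\bmod 2,x\bmod n)$, and $\psi\colon\mathbb Z_2\times\mathbb Z_n\to D_{2n}$ the set bijection $(i,j)\mapsto s^ir^j$; $\mathcal P(X):=\psi(\varphi(X))$. A subset $\widetilde X\subseteq D_{2n}$ is strongly symmetric if for all $j$: $r^j\in\widetilde X\iff r^{ -j}\in\widetilde X$, and $sr^j\in\widetilde X\iff sr^{ -j}\in\widetilde X$. -}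

module Defs where

open import Data.Nat using (ℕ; zero; suc; _+_; _*_; _∸_; _%_)
open import Data.Nat.DivMod using (_mod_)
open import Data.Fin using (Fin; toℕ)
open import Data.Fin.Properties using (_≟_)
open import Data.Bool using (Bool; true; false; _∧_; if_then_else_)
open import Data.List using (List; map; cartesianProduct; allFin)
open import Data.Bool.ListAction using (any)
open import Data.Nat.ListAction using (sum)
open import Data.Product using (_×_; _,_; proj₁; proj₂)
import Data.Product.Properties as ×P
open import Relation.Binary.PropositionalEquality using (_≡_)
open import Relation.Binary.Definitions using (DecidableEquality)
open import Relation.Nullary.Decidable using (⌊_⌋)
open import Function.Definitions using (Bijective)

Subset : Set → Set
Subset A = A → Bool

image : {A B : Set} → List A → DecidableEquality B → (A → B) → Subset A → Subset B
image enumA _≟B_ f X y = any (λ x → X x ∧ ⌊ f x ≟B y ⌋) enumA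

sumOver : {A : Set} → List A → (A → ℕ) → ℕ
sumOver enum g = sum (map g enum)

cayleyMat : {H : Set} → (H → H → H) → (H → H) → Subset H → H → H → ℕ
cayleyMat mul inv X g h = if X (mul (inv g) h) then 1 else 0

matMul : {H : Set} → List H → (H → H → ℕ) → (H → H → ℕ) → H → H → ℕ
matMul enum M N g h = sumOver enum (λ k → M g k * N k h)

IsAut : {H : Set} → (H → H → H) → (H → H) → Set
IsAut mul f = Bijective _≡_ _≡_ f × (∀ x y → f (mul x y) ≡ mul (f x) (f y))

-- arithmetic in Fin m (= ℤ_m); for m = 0 there are no elements

addMod : ∀ {m} → Fin m → Fin m → Fin m
addMod {suc k} x y = (toℕ x + toℕ y) mod (suc k)

negMod : ∀ {m} → Fin m → Fin m
negMod {suc k} x = (suc k ∸ toℕ x) mod (suc k)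

Odd : ℕ → Set
Odd n = n % 2 ≡ 1

Z : ℕ → Set
Z n = Fin (2 * n)

addZ : ∀ n → Z n → Z n → Z n
addZ n = addMod

negZ : ∀ n → Z n → Z n
negZ n = negMod

enumZ : ∀ n → List (Z n)
enumZ n = allFin (2 * n)

AZ : ∀ n → Subset (Z n) → Z n → Z n → ℕ
AZ n = cayleyMat (addZ n) (negZ n)

AvoidsZeroZ : ∀ n → Subset (Z n) → Set
AvoidsZeroZ n X = ∀ x → toℕ x ≡ 0 → X x ≡ false

SymmetricZ : ∀ n → Subset (Z n) → Set
SymmetricZ n X = ∀ x → X (negZ n x) ≡ X x

ProductRelZ : ∀ n → Subset (Z n) → Subset (Z n) → Subset (Z n) → Set
ProductRelZ n S T U =
  ∀ g h → AZ n U g h ≡ matMul (enumZ n) (AZ n S) (AZ n T) g h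

imageZ : ∀ n → (Z n → Z n) → Subset (Z n) → Subset (Z n)
imageZ n = image (enumZ n) _≟_

-- D_{2n}: the element s^i r^j is represented by (i , j) ∈ Fin 2 × Fin n
-- (normal form; ψ is this identification).  Multiplication:
-- s^i r^j · s^k r^l = s^{i+k} r^{(-1)^k j + l}.

D : ℕ → Set
D n = Fin 2 × Fin n

signAct : ∀ {n} → Fin 2 → Fin n → Fin n
signAct i j with toℕ i
... | zero = j
... | suc _ = negMod j

mulD : ∀ n → D n → D n → D n
mulD n (i , j) (k , l) = addMod i k , addMod (signAct k j) l

-- (r^j)⁻¹ = r^{-j},  (s r^j)⁻¹ = s r^j
invD : ∀ n → D n → D n
invD n (i , j) = i , signAct i (negMod j)

enumD : ∀ n → List (D n)
enumD n = cartesianProduct (allFin 2) (allFin n)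

_≟D_ : ∀ {n} → DecidableEquality (D n)
_≟D_ = ×P.≡-dec _≟_ _≟_

AD : ∀ n → Subset (D n) → D n → D n → ℕ
AD n = cayleyMat (mulD n) (invD n)

AvoidsIdD : ∀ n → Subset (D n) → Set
AvoidsIdD n X = ∀ d → toℕ (proj₁ d) ≡ 0 → toℕ (proj₂ d) ≡ 0 → X d ≡ false

SymmetricD : ∀ n → Subset (D n) → Set
SymmetricD n X = ∀ d → X (invD n d) ≡ X d

StronglySymmetricD : ∀ n → Subset (D n) → Set
StronglySymmetricD n X = ∀ i j → X (i , negMod j) ≡ X (i , j)

ProductRelD : ∀ n → Subset (D n) → Subset (D n) → Subset (D n) → Set
ProductRelD n S T U =
  ∀ g h → AD n U g h ≡ matMul (enumD n) (AD n S) (AD n T) g h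

imageD : ∀ n → (D n → D n) → Subset (D n) → Subset (D n)
imageD n = image (enumD n) _≟D_

φ : ∀ n → Z n → Fin 2 × Fin n
φ zero ()
φ (suc k) x = toℕ x mod 2 , toℕ x mod suc k

-- 𝒫(X) = ψ(φ(X))
𝒫 : ∀ n → Subset (Z n) → Subset (D n)
𝒫 n X = image (enumZ n) _≟D_ (φ n) X

-- For odd n the remainder map φ : ℤ_{2n} → ℤ₂ × ℤₙ is a group isomorphism (inverse ψ), so
-- 𝒫 X is X ∘ ψ read on normal forms s^i r^j, and symmetry of X is exactly strong symmetry
-- of 𝒫 X.  Writing g = r^{j'} s^i, the element g⁻¹h of D_{2n} agrees, up to the sign of its
-- r-exponent, with the difference of the corresponding elements of ℤ₂ × ℤₙ.  Hence for
-- symmetric X the matrix A(D_{2n}; 𝒫 X) is A(ℤ_{2n}; X) with rows and columns permuted by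
-- one bijection κ, and matrix products are preserved.  An automorphism α of ℤ_{2n} fixes n,
-- its only involution, and preserves parity, so φ ∘ α ∘ ψ is s^i r^j ↦ s^i r^{c j} with
-- c additive: an automorphism of D_{2n} carrying 𝒫 X to 𝒫 (α X).
module Submission where

open import Algebra.Bundles using (AbelianGroup)
import Algebra.Properties.AbelianGroup as AbelianGroupProperties
open import Algebra.Structures using (IsAbelianGroup)
open import Data.Bool using (Bool; true; false; _∧_; if_then_else_)
open import Data.Bool.ListAction using (any)
open import Data.Bool.Properties using (∨-zeroʳ; ∧-zeroʳ)
open import Data.Fin using (Fin; toℕ; fromℕ<) renaming (zero to fzero; suc to fsuc)
open import Data.Fin.Properties using (_≟_; toℕ-injective; toℕ-fromℕ<; toℕ<n)
open import Data.List using (List; []; _∷_; map)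
open import Data.List.Membership.Propositional using (_∈_)
open import Data.List.Membership.Propositional.Properties using (∈-map⁺; ∈-allFin; ∈-cartesianProduct⁺)
open import Data.List.Membership.Propositional.Properties.WithK using (unique∧set⇒bag)
open import Data.List.Properties using (map-∘; map-cong)
open import Data.List.Relation.Binary.BagAndSetEquality using (∼bag⇒↭)
open import Data.List.Relation.Binary.Permutation.Propositional using (_↭_)
import Data.List.Relation.Binary.Permutation.Propositional.Properties as ↭
open import Data.List.Relation.Unary.Any using (here; there)
open import Data.List.Relation.Unary.Unique.Propositional using (Unique)
import Data.List.Relation.Unary.Unique.Propositional.Properties as Unique
open import Data.Nat using (ℕ; zero; suc; _+_; _*_; _∸_; _%_; _/_; _<_; _≤_; s≤s)
open import Data.Nat.DivMod
open import Data.Nat.Divisibility using (_∣_; m∣m*n; n∣m*n)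
open import Data.Nat.ListAction using (sum)
open import Data.Nat.ListAction.Properties using (sum-↭)
open import Data.Nat.Properties
  using ( +-assoc; +-comm; +-identityʳ; *-comm; *-identityˡ; *-identityʳ; *-cancelˡ-≡
        ; *-monoʳ-<; *-monoˡ-≤; +-monoˡ-<; +-monoʳ-≤; ≤-<-trans; ≤-pred; <⇒≤
        ; m+n≡0⇒m≡0; m+[n∸m]≡n; module ≤-Reasoning )
open import Data.Nat.Tactic.RingSolver using (solve-∀)
open import Data.Product using (_×_; _,_; Σ; ∃-syntax; proj₁; proj₂; map₂)
open import Function using (_∘_; mk⇔)
import Function.Construct.Composition as Composition
open import Function.Consequences.Propositional
  using (inverseᵇ⇒bijective; strictlyInverseˡ⇒inverseˡ; strictlyInverseʳ⇒inverseʳ)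
open import Function.Definitions using (Injective; Bijective)
open import Level using (0ℓ)
open import Relation.Binary.Definitions using (DecidableEquality)
open import Relation.Binary.PropositionalEquality
open import Relation.Nullary.Decidable using (⌊_⌋; isYes≗does; dec-true; yes; no)
open import Relation.Nullary.Negation using (contradiction)

open import Defs

Additive : ∀ {k l} → (Fin (suc k) → Fin (suc l)) → Set
Additive h = ∀ x y → h (addMod x y) ≡ addMod (h x) (h y)

module _ {k : ℕ} where
  private
    m = suc k

  toℕ-addMod : (x y : Fin m) → toℕ (addMod x y) ≡ (toℕ x + toℕ y) % m
  toℕ-addMod x y = toℕ-fromℕ< _

  toℕ-negMod : (x : Fin m) → toℕ (negMod x) ≡ (m ∸ toℕ x) % m
  toℕ-negMod x = toℕ-fromℕ< _

  [m%n+o]%n≡[m+o]%n : ∀ a b → (a % m + b) % m ≡ (a + b) % m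
  [m%n+o]%n≡[m+o]%n a b = begin
    (a % m + b) % m           ≡⟨ %-distribˡ-+ (a % m) b m ⟩
    (a % m % m + b % m) % m   ≡⟨ cong (λ t → (t + b % m) % m) (m%n%n≡m%n a m) ⟩
    (a % m + b % m) % m       ≡⟨ %-distribˡ-+ a b m ⟨
    (a + b) % m               ∎
    where open ≡-Reasoning

  [m+o%n]%n≡[m+o]%n : ∀ a b → (a + b % m) % m ≡ (a + b) % m
  [m+o%n]%n≡[m+o]%n a b = begin
    (a + b % m) % m   ≡⟨ cong (_% m) (+-comm a (b % m)) ⟩
    (b % m + a) % m   ≡⟨ [m%n+o]%n≡[m+o]%n b a ⟩
    (b + a) % m       ≡⟨ cong (_% m) (+-comm b a) ⟩
    (a + b) % m       ∎
    where open ≡-Reasoning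

  addMod-assoc : ∀ x y z → addMod (addMod x y) z ≡ addMod x (addMod y z)
  addMod-assoc x y z = toℕ-injective (begin
    toℕ (addMod (addMod x y) z)        ≡⟨ toℕ-addMod (addMod x y) z ⟩
    (toℕ (addMod x y) + toℕ z) % m     ≡⟨ cong (λ t → (t + toℕ z) % m) (toℕ-addMod x y) ⟩
    ((toℕ x + toℕ y) % m + toℕ z) % m  ≡⟨ [m%n+o]%n≡[m+o]%n (toℕ x + toℕ y) (toℕ z) ⟩
    (toℕ x + toℕ y + toℕ z) % m        ≡⟨ cong (_% m) (+-assoc (toℕ x) (toℕ y) (toℕ z)) ⟩
    (toℕ x + (toℕ y + toℕ z)) % m      ≡⟨ [m+o%n]%n≡[m+o]%n (toℕ x) (toℕ y + toℕ z) ⟨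
    (toℕ x + (toℕ y + toℕ z) % m) % m  ≡⟨ cong (λ t → (toℕ x + t) % m) (toℕ-addMod y z) ⟨
    (toℕ x + toℕ (addMod y z)) % m     ≡⟨ toℕ-addMod x (addMod y z) ⟨
    toℕ (addMod x (addMod y z))        ∎)
    where open ≡-Reasoning

  addMod-comm : ∀ x y → addMod x y ≡ addMod y x
  addMod-comm x y = toℕ-injective (begin
    toℕ (addMod x y)      ≡⟨ toℕ-addMod x y ⟩
    (toℕ x + toℕ y) % m   ≡⟨ cong (_% m) (+-comm (toℕ x) (toℕ y)) ⟩
    (toℕ y + toℕ x) % m   ≡⟨ toℕ-addMod y x ⟨
    toℕ (addMod y x)      ∎)
    where open ≡-Reasoning

  addMod-identityˡ : ∀ x → addMod fzero x ≡ x
  addMod-identityˡ x = toℕ-injective (trans (toℕ-addMod fzero x) (m<n⇒m%n≡m (toℕ<n x)))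

  addMod-identityʳ : ∀ x → addMod x fzero ≡ x
  addMod-identityʳ x = trans (addMod-comm x fzero) (addMod-identityˡ x)

  addMod-inverseʳ : ∀ x → addMod x (negMod x) ≡ fzero
  addMod-inverseʳ x = toℕ-injective (begin
    toℕ (addMod x (negMod x))            ≡⟨ toℕ-addMod x (negMod x) ⟩
    (toℕ x + toℕ (negMod x)) % m         ≡⟨ cong (λ t → (toℕ x + t) % m) (toℕ-negMod x) ⟩
    (toℕ x + (m ∸ toℕ x) % m) % m        ≡⟨ [m+o%n]%n≡[m+o]%n (toℕ x) (m ∸ toℕ x) ⟩
    (toℕ x + (m ∸ toℕ x)) % m            ≡⟨ cong (_% m) (m+[n∸m]≡n (<⇒≤ (toℕ<n x))) ⟩
    m % m                                ≡⟨ n%n≡0 m ⟩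
    0                                    ∎)
    where open ≡-Reasoning

  addMod-inverseˡ : ∀ x → addMod (negMod x) x ≡ fzero
  addMod-inverseˡ x = trans (addMod-comm (negMod x) x) (addMod-inverseʳ x)

  addMod-isAbelianGroup : IsAbelianGroup _≡_ addMod fzero (negMod {m})
  addMod-isAbelianGroup = record
    { isGroup = record
      { isMonoid = record
        { isSemigroup = record
          { isMagma = record { isEquivalence = isEquivalence ; ∙-cong = cong₂ addMod }
          ; assoc = addMod-assoc
          }
        ; identity = addMod-identityˡ , addMod-identityʳ
        }
      ; inverse = addMod-inverseˡ , addMod-inverseʳ
      ; ⁻¹-cong = cong negMod
      }
    ; comm = addMod-comm
    }

addMod-abelianGroup : ℕ → AbelianGroup 0ℓ 0ℓ
addMod-abelianGroup k = record { isAbelianGroup = addMod-isAbelianGroup {k} }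

private
  module ModProps (k : ℕ) = AbelianGroupProperties (addMod-abelianGroup k)

negMod-involutive : ∀ {k} (x : Fin (suc k)) → negMod (negMod x) ≡ x
negMod-involutive {k} = ModProps.⁻¹-involutive k

negMod-addMod : ∀ {k} (x y : Fin (suc k)) → negMod (addMod x y) ≡ addMod (negMod x) (negMod y)
negMod-addMod {k} x y = sym (ModProps.⁻¹-∙-comm k x y)

module _ {j k : ℕ} (h : Fin (suc j) → Fin (suc k)) (h-additive : Additive h) where

  additive⇒zero-homo : h fzero ≡ fzero
  additive⇒zero-homo = ModProps.identityˡ-unique k (h fzero) (h fzero) (sym (h-additive fzero fzero))

  additive⇒negMod-homo : ∀ x → h (negMod x) ≡ negMod (h x)
  additive⇒negMod-homo x = ModProps.inverseʳ-unique k (h x) (h (negMod x))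
    (trans (sym (h-additive x (negMod x))) (trans (cong h (addMod-inverseʳ x)) additive⇒zero-homo))

negMod-Fin2 : (i : Fin 2) → negMod i ≡ i
negMod-Fin2 fzero        = refl
negMod-Fin2 (fsuc fzero) = refl

addMod-self-Fin2 : (i : Fin 2) → addMod i i ≡ fzero
addMod-self-Fin2 fzero        = refl
addMod-self-Fin2 (fsuc fzero) = refl

-- φ n x is definitionally (reduce 1 x , reduce (n ∸ 1) x)
reduce : ∀ {m} d → Fin m → Fin (suc d)
reduce d x = toℕ x mod suc d

toℕ-reduce : ∀ {m} d (x : Fin m) → toℕ (reduce d x) ≡ toℕ x % suc d
toℕ-reduce d x = toℕ-fromℕ< _

reduce-additive : ∀ {m d} → suc d ∣ suc m → Additive (reduce {suc m} d)
reduce-additive {m} {d} d∣m x y = toℕ-injective (begin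
  toℕ (reduce d (addMod x y))                   ≡⟨ toℕ-reduce d (addMod x y) ⟩
  toℕ (addMod x y) % suc d                      ≡⟨ cong (_% suc d) (toℕ-addMod x y) ⟩
  (toℕ x + toℕ y) % suc m % suc d               ≡⟨ m∣n⇒o%n%m≡o%m (suc d) (suc m) (toℕ x + toℕ y) d∣m ⟩
  (toℕ x + toℕ y) % suc d                       ≡⟨ %-distribˡ-+ (toℕ x) (toℕ y) (suc d) ⟩
  (toℕ x % suc d + toℕ y % suc d) % suc d       ≡⟨ cong₂ (λ a b → (a + b) % suc d) (toℕ-reduce d x) (toℕ-reduce d y) ⟨
  (toℕ (reduce d x) + toℕ (reduce d y)) % suc d ≡⟨ toℕ-addMod (reduce d x) (reduce d y) ⟨
  toℕ (addMod (reduce d x) (reduce d y))        ∎)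
  where open ≡-Reasoning

module _ {A : Set} where

  any-true : (p : A → Bool) {x : A} {xs : List A} → x ∈ xs → p x ≡ true → any p xs ≡ true
  any-true p (here refl) px rewrite px = refl
  any-true p {xs = y ∷ _} (there x∈xs) px rewrite any-true p x∈xs px = ∨-zeroʳ (p y)

  any-false : (p : A → Bool) → (∀ x → p x ≡ false) → ∀ xs → any p xs ≡ false
  any-false p p≡false []       = refl
  any-false p p≡false (x ∷ xs) rewrite p≡false x = any-false p p≡false xs

image-injective : {A B : Set} (as : List A) (_≟_ : DecidableEquality B) {f : A → B} →
                  Injective _≡_ _≡_ f → (X : Subset A) {a : A} {y : B} →
                  a ∈ as → f a ≡ y → image as _≟_ f X y ≡ X a
image-injective as _≟_ {f} f-inj X {a} {y} a∈as fa≡y with X a in Xa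
... | true  = any-true _ a∈as (cong₂ _∧_ Xa (trans (isYes≗does (f a ≟ y)) (dec-true (f a ≟ y) fa≡y)))
... | false = any-false _ X∧f≡y-false as
  where
  X∧f≡y-false : ∀ x → (X x ∧ ⌊ f x ≟ y ⌋) ≡ false
  X∧f≡y-false x with f x ≟ y
  ... | yes fx≡y rewrite f-inj (trans fx≡y (sym fa≡y)) = cong (_∧ true) Xa
  ... | no _     = ∧-zeroʳ (X x)

module _ {A B : Set} {as : List A} {bs : List B}
         (as-unique : Unique as) (as-complete : ∀ a → a ∈ as)
         (bs-unique : Unique bs) (bs-complete : ∀ b → b ∈ bs)
         {τ : A → B} (τ-bijective : Bijective _≡_ _≡_ τ) where

  map-bijective-↭ : map τ as ↭ bs
  map-bijective-↭ = ∼bag⇒↭ (unique∧set⇒bag (Unique.map⁺ τ-injective as-unique) bs-unique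
    (λ {b} → mk⇔ (λ _ → bs-complete b) (λ _ → b∈τ[as] b)))
    where
    τ-injective = proj₁ τ-bijective
    b∈τ[as] : ∀ b → b ∈ map τ as
    b∈τ[as] b with a , τa≡b ← proj₂ τ-bijective b =
      subst (_∈ map τ as) (τa≡b refl) (∈-map⁺ τ (as-complete a))

  sumOver-reindex : (F : B → ℕ) → sumOver as (F ∘ τ) ≡ sumOver bs F
  sumOver-reindex F = begin
    sum (map (F ∘ τ) as)   ≡⟨ cong sum (map-∘ as) ⟩
    sum (map F (map τ as)) ≡⟨ sum-↭ (↭.map⁺ F map-bijective-↭) ⟩
    sum (map F bs)         ∎
    where open ≡-Reasoning

  matMul-reindex : {M′ N′ : A → A → ℕ} (M N : B → B → ℕ) →
                   (∀ g h → M′ g h ≡ M (τ g) (τ h)) → (∀ g h → N′ g h ≡ N (τ g) (τ h)) →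
                   ∀ g h → matMul as M′ N′ g h ≡ matMul bs M N (τ g) (τ h)
  matMul-reindex {M′} {N′} M N M′≡M N′≡N g h = begin
    sumOver as (λ c → M′ g c * N′ c h)
      ≡⟨ cong sum (map-cong (λ c → cong₂ _*_ (M′≡M g c) (N′≡N c h)) as) ⟩
    sumOver as (λ c → M (τ g) (τ c) * N (τ c) (τ h))
      ≡⟨ sumOver-reindex (λ b → M (τ g) b * N b (τ h)) ⟩
    sumOver bs (λ b → M (τ g) b * N b (τ h))
      ∎
    where open ≡-Reasoning

module _ {k : ℕ} where
  private
    n = suc k

  signAct-additive : (c : Fin 2) → Additive (signAct {n} c)
  signAct-additive fzero        j l = refl
  signAct-additive (fsuc fzero) j l = negMod-addMod j l

  signAct-involutive : (c : Fin 2) (j : Fin n) → signAct c (signAct c j) ≡ j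
  signAct-involutive fzero        j = refl
  signAct-involutive (fsuc fzero) j = negMod-involutive j

  signAct-negMod : (c : Fin 2) (j : Fin n) → signAct c (negMod j) ≡ negMod (signAct c j)
  signAct-negMod fzero        j = refl
  signAct-negMod (fsuc fzero) j = refl

  additive⇒signAct-homo : {c : Fin n → Fin n} → Additive c → ∀ i j → c (signAct i j) ≡ signAct i (c j)
  additive⇒signAct-homo c-additive fzero        j = refl
  additive⇒signAct-homo {c} c-additive (fsuc fzero) j = additive⇒negMod-homo c c-additive j

  module _ {Y : Subset (D n)} (Y-strong : StronglySymmetricD n Y) where

    stronglySymmetric-signAct : ∀ i c j → Y (i , signAct c j) ≡ Y (i , j)
    stronglySymmetric-signAct i fzero        j = refl
    stronglySymmetric-signAct i (fsuc fzero) j = Y-strong i j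

    stronglySymmetric⇒symmetric : SymmetricD n Y
    stronglySymmetric⇒symmetric (i , j) =
      trans (stronglySymmetric-signAct i i (negMod j)) (Y-strong i j)

  onRotations : (Fin n → Fin n) → D n → D n
  onRotations c (i , j) = i , c j

  onRotations-homo : {c : Fin n → Fin n} → Additive c →
                     ∀ g h → onRotations c (mulD n g h) ≡ mulD n (onRotations c g) (onRotations c h)
  onRotations-homo {c} c-additive (i , j) (i′ , j′) = cong (addMod i i′ ,_) (begin
    c (addMod (signAct i′ j) j′)        ≡⟨ c-additive (signAct i′ j) j′ ⟩
    addMod (c (signAct i′ j)) (c j′)    ≡⟨ cong (λ t → addMod t (c j′)) (additive⇒signAct-homo c-additive i′ j) ⟩
    addMod (signAct i′ (c j)) (c j′)    ∎)
    where open ≡-Reasoning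

  infixl 6 _⊕_

  -- the group ℤ₂ × ℤₙ, on the carrier of D_{2n}
  _⊕_ : D n → D n → D n
  (i , j) ⊕ (i′ , j′) = addMod i i′ , addMod j j′

  -- -i = i in ℤ₂
  ⊖_ : D n → D n
  ⊖ (i , j) = i , negMod j

  -- s^i r^j = r^((-1)^i j) s^i, and twist reads off the exponents of the second form
  twist : D n → D n
  twist (i , j) = i , signAct i j

  twist-involutive : ∀ d → twist (twist d) ≡ d
  twist-involutive (i , j) = cong (i ,_) (signAct-involutive i j)

  invD-mulD-twist : ∀ g h → mulD n (invD n g) h ≡ map₂ (signAct (proj₁ h)) (⊖ twist g ⊕ twist h)
  invD-mulD-twist (i , j) (i′ , j′) = cong (addMod i i′ ,_) (sym (begin
    signAct i′ (addMod (negMod (signAct i j)) (signAct i′ j′))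
      ≡⟨ signAct-additive i′ (negMod (signAct i j)) (signAct i′ j′) ⟩
    addMod (signAct i′ (negMod (signAct i j))) (signAct i′ (signAct i′ j′))
      ≡⟨ cong₂ addMod (cong (signAct i′) (sym (signAct-negMod i j))) (signAct-involutive i′ j′) ⟩
    addMod (signAct i′ (signAct i (negMod j))) j′ ∎))
    where open ≡-Reasoning

  stronglySymmetric-invD-mulD : {Y : Subset (D n)} → StronglySymmetricD n Y →
                                ∀ g h → Y (mulD n (invD n g) h) ≡ Y (⊖ twist g ⊕ twist h)
  stronglySymmetric-invD-mulD {Y} Y-strong g h = trans (cong Y (invD-mulD-twist g h))
    (stronglySymmetric-signAct Y-strong _ (proj₁ h) _)

enumD-unique : ∀ n → Unique (enumD n)
enumD-unique n = Unique.cartesianProduct⁺ (Unique.allFin⁺ 2) (Unique.allFin⁺ n)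

∈-enumD : ∀ {n} (d : D n) → d ∈ enumD n
∈-enumD (i , j) = ∈-cartesianProduct⁺ (∈-allFin i) (∈-allFin j)

-- ψ (i , j) is whichever of j and j + n has parity i; for odd n exactly one of them does
ψ : ∀ n → D n → Z n
ψ n (i , j) = fromℕ< bound
  where
  bound : toℕ j + ((toℕ i + toℕ j) % 2) * n < 2 * n
  bound = begin-strict
    toℕ j + ((toℕ i + toℕ j) % 2) * n <⟨ +-monoˡ-< _ (toℕ<n j) ⟩
    n + ((toℕ i + toℕ j) % 2) * n     ≤⟨ +-monoʳ-≤ n (*-monoˡ-≤ n (≤-pred (m%n<n (toℕ i + toℕ j) 2))) ⟩
    n + 1 * n                         ∎
    where open ≤-Reasoning

module _ {k : ℕ} where
  private
    n = suc k

  toℕ-ψ : ∀ i j → toℕ (ψ n (i , j)) ≡ toℕ j + ((toℕ i + toℕ j) % 2) * n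
  toℕ-ψ i j = toℕ-fromℕ< _

  φ-additive : ∀ x y → φ n (addZ n x y) ≡ φ n x ⊕ φ n y
  φ-additive x y = cong₂ _,_ (reduce-additive (m∣m*n n) x y) (reduce-additive (n∣m*n 2) x y)

  φ-negZ : ∀ x → φ n (negZ n x) ≡ ⊖ φ n x
  φ-negZ x = cong₂ _,_
    (trans (additive⇒negMod-homo (reduce 1) (reduce-additive (m∣m*n n)) x) (negMod-Fin2 _))
    (additive⇒negMod-homo (reduce k) (reduce-additive (n∣m*n 2)) x)

  module _ (n-odd : Odd n) where

    *-odd-%2 : ∀ e → (e * n) % 2 ≡ e % 2
    *-odd-%2 e = begin
      (e * n) % 2             ≡⟨ %-distribˡ-* e n 2 ⟩
      (e % 2 * (n % 2)) % 2   ≡⟨ cong (λ t → (e % 2 * t) % 2) n-odd ⟩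
      (e % 2 * 1) % 2         ≡⟨ cong (_% 2) (*-identityʳ (e % 2)) ⟩
      e % 2 % 2               ≡⟨ m%n%n≡m%n e 2 ⟩
      e % 2                   ∎
      where open ≡-Reasoning

    φ∘ψ : ∀ d → φ n (ψ n d) ≡ d
    φ∘ψ (i , j) = cong₂ _,_ (toℕ-injective parity) (toℕ-injective residue)
      where
      open ≡-Reasoning
      e = (toℕ i + toℕ j) % 2
      residue : toℕ (reduce k (ψ n (i , j))) ≡ toℕ j
      residue = begin
        toℕ (reduce k (ψ n (i , j))) ≡⟨ toℕ-reduce k (ψ n (i , j)) ⟩
        toℕ (ψ n (i , j)) % n        ≡⟨ cong (_% n) (toℕ-ψ i j) ⟩
        (toℕ j + e * n) % n          ≡⟨ [m+kn]%n≡m%n (toℕ j) e n ⟩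
        toℕ j % n                    ≡⟨ m<n⇒m%n≡m (toℕ<n j) ⟩
        toℕ j                        ∎
      rearrange : ∀ a b → b + (a + b) ≡ a + b * 2
      rearrange = solve-∀
      parity : toℕ (reduce 1 (ψ n (i , j))) ≡ toℕ i
      parity = begin
        toℕ (reduce 1 (ψ n (i , j)))           ≡⟨ toℕ-reduce 1 (ψ n (i , j)) ⟩
        toℕ (ψ n (i , j)) % 2                  ≡⟨ cong (_% 2) (toℕ-ψ i j) ⟩
        (toℕ j + e * n) % 2                    ≡⟨ %-distribˡ-+ (toℕ j) (e * n) 2 ⟩
        (toℕ j % 2 + (e * n) % 2) % 2
          ≡⟨ cong (λ t → (toℕ j % 2 + t) % 2) (trans (*-odd-%2 e) (m%n%n≡m%n (toℕ i + toℕ j) 2)) ⟩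
        (toℕ j % 2 + (toℕ i + toℕ j) % 2) % 2  ≡⟨ %-distribˡ-+ (toℕ j) (toℕ i + toℕ j) 2 ⟨
        (toℕ j + (toℕ i + toℕ j)) % 2          ≡⟨ cong (_% 2) (rearrange (toℕ i) (toℕ j)) ⟩
        (toℕ i + toℕ j * 2) % 2                ≡⟨ [m+kn]%n≡m%n (toℕ i) (toℕ j) 2 ⟩
        toℕ i % 2                              ≡⟨ m<n⇒m%n≡m (toℕ<n i) ⟩
        toℕ i                                  ∎

    ψ∘φ : ∀ x → ψ n (φ n x) ≡ x
    ψ∘φ x = toℕ-injective (begin
      toℕ (ψ n (reduce 1 x , reduce k x))
        ≡⟨ toℕ-ψ (reduce 1 x) (reduce k x) ⟩
      toℕ (reduce k x) + ((toℕ (reduce 1 x) + toℕ (reduce k x)) % 2) * n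
        ≡⟨ cong₂ (λ u v → v + ((u + v) % 2) * n) (toℕ-reduce 1 x) (toℕ-reduce k x) ⟩
      r + ((a % 2 + r) % 2) * n
        ≡⟨ cong (λ t → r + t * n) parity≡quotient ⟩
      r + q * n
        ≡⟨ m≡m%n+[m/n]*n a n ⟨
      a ∎)
      where
      open ≡-Reasoning
      a = toℕ x
      r = a % n
      q = a / n
      rearrange : ∀ u v → u + v + u ≡ v + u * 2
      rearrange = solve-∀
      parity≡quotient : (a % 2 + r) % 2 ≡ q
      parity≡quotient = begin
        (a % 2 + r) % 2      ≡⟨ [m%n+o]%n≡[m+o]%n a r ⟩
        (a + r) % 2          ≡⟨ cong (λ t → (t + r) % 2) (m≡m%n+[m/n]*n a n) ⟩
        (r + q * n + r) % 2  ≡⟨ cong (_% 2) (rearrange r (q * n)) ⟩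
        (q * n + r * 2) % 2  ≡⟨ [m+kn]%n≡m%n (q * n) r 2 ⟩
        (q * n) % 2          ≡⟨ *-odd-%2 q ⟩
        q % 2                ≡⟨ m<n⇒m%n≡m (m<n*o⇒m/o<n (toℕ<n x)) ⟩
        q                    ∎

    φ-bijective : Bijective _≡_ _≡_ (φ n)
    φ-bijective = inverseᵇ⇒bijective
      ( strictlyInverseˡ⇒inverseˡ {f⁻¹ = ψ n} (φ n) φ∘ψ
      , strictlyInverseʳ⇒inverseʳ {f⁻¹ = ψ n} (φ n) ψ∘φ )

    φ-injective : Injective _≡_ _≡_ (φ n)
    φ-injective = proj₁ φ-bijective

    ψ-bijective : Bijective _≡_ _≡_ (ψ n)
    ψ-bijective = inverseᵇ⇒bijective
      ( strictlyInverseˡ⇒inverseˡ {f⁻¹ = φ n} (ψ n) ψ∘φ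
      , strictlyInverseʳ⇒inverseʳ {f⁻¹ = φ n} (ψ n) φ∘ψ )

    ψ-⊕ : ∀ a b → ψ n (a ⊕ b) ≡ addZ n (ψ n a) (ψ n b)
    ψ-⊕ a b = φ-injective (begin
      φ n (ψ n (a ⊕ b))                 ≡⟨ φ∘ψ (a ⊕ b) ⟩
      a ⊕ b                             ≡⟨ cong₂ _⊕_ (φ∘ψ a) (φ∘ψ b) ⟨
      φ n (ψ n a) ⊕ φ n (ψ n b)         ≡⟨ φ-additive (ψ n a) (ψ n b) ⟨
      φ n (addZ n (ψ n a) (ψ n b))      ∎)
      where open ≡-Reasoning

    ψ-⊖ : ∀ a → ψ n (⊖ a) ≡ negZ n (ψ n a)
    ψ-⊖ a = φ-injective (begin
      φ n (ψ n (⊖ a))         ≡⟨ φ∘ψ (⊖ a) ⟩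
      ⊖ a                     ≡⟨ cong ⊖_ (φ∘ψ a) ⟨
      ⊖ φ n (ψ n a)           ≡⟨ φ-negZ (ψ n a) ⟨
      φ n (negZ n (ψ n a))    ∎)
      where open ≡-Reasoning

    𝒫-ψ : ∀ X d → 𝒫 n X d ≡ X (ψ n d)
    𝒫-ψ X d = image-injective (enumZ n) _≟D_ φ-injective X (∈-allFin (ψ n d)) (φ∘ψ d)

    𝒫-stronglySymmetric : ∀ {X} → SymmetricZ n X → StronglySymmetricD n (𝒫 n X)
    𝒫-stronglySymmetric {X} X-symmetric i j = begin
      𝒫 n X (i , negMod j)       ≡⟨ 𝒫-ψ X (⊖ (i , j)) ⟩
      X (ψ n (⊖ (i , j)))        ≡⟨ cong X (ψ-⊖ (i , j)) ⟩
      X (negZ n (ψ n (i , j)))   ≡⟨ X-symmetric (ψ n (i , j)) ⟩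
      X (ψ n (i , j))            ≡⟨ 𝒫-ψ X (i , j) ⟨
      𝒫 n X (i , j)              ∎
      where open ≡-Reasoning

    𝒫-avoidsId : ∀ {X} → AvoidsZeroZ n X → AvoidsIdD n (𝒫 n X)
    𝒫-avoidsId {X} X-avoids (fzero , fzero) _ _ = trans (𝒫-ψ X (fzero , fzero)) (X-avoids _ refl)

    κ : D n → Z n
    κ = ψ n ∘ twist

    κ⁻¹ : Z n → D n
    κ⁻¹ = twist ∘ φ n

    κ∘κ⁻¹ : ∀ x → κ (κ⁻¹ x) ≡ x
    κ∘κ⁻¹ x = trans (cong (ψ n) (twist-involutive (φ n x))) (ψ∘φ x)

    κ⁻¹∘κ : ∀ d → κ⁻¹ (κ d) ≡ d
    κ⁻¹∘κ d = trans (cong twist (φ∘ψ (twist d))) (twist-involutive d)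

    κ-bijective : Bijective _≡_ _≡_ κ
    κ-bijective = inverseᵇ⇒bijective
      ( strictlyInverseˡ⇒inverseˡ {f⁻¹ = κ⁻¹} κ κ∘κ⁻¹
      , strictlyInverseʳ⇒inverseʳ {f⁻¹ = κ⁻¹} κ κ⁻¹∘κ )

    𝒫-cayleyMat : ∀ {X} → SymmetricZ n X → ∀ g h → AD n (𝒫 n X) g h ≡ AZ n X (κ g) (κ h)
    𝒫-cayleyMat {X} X-symmetric g h = cong (λ b → if b then 1 else 0) (begin
      𝒫 n X (mulD n (invD n g) h)             ≡⟨ stronglySymmetric-invD-mulD (𝒫-stronglySymmetric X-symmetric) g h ⟩
      𝒫 n X (⊖ twist g ⊕ twist h)             ≡⟨ 𝒫-ψ X (⊖ twist g ⊕ twist h) ⟩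
      X (ψ n (⊖ twist g ⊕ twist h))           ≡⟨ cong X (ψ-⊕ (⊖ twist g) (twist h)) ⟩
      X (addZ n (ψ n (⊖ twist g)) (κ h))      ≡⟨ cong (λ t → X (addZ n t (κ h))) (ψ-⊖ (twist g)) ⟩
      X (addZ n (negZ n (κ g)) (κ h))         ∎)
      where open ≡-Reasoning

    𝒫-productRel : ∀ {S T U} → SymmetricZ n S → SymmetricZ n T → SymmetricZ n U →
                   ProductRelZ n S T U → ProductRelD n (𝒫 n S) (𝒫 n T) (𝒫 n U)
    𝒫-productRel {S} {T} {U} S-symmetric T-symmetric U-symmetric U≡ST g h = begin
      AD n (𝒫 n U) g h                                    ≡⟨ 𝒫-cayleyMat U-symmetric g h ⟩
      AZ n U (κ g) (κ h)                                  ≡⟨ U≡ST (κ g) (κ h) ⟩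
      matMul (enumZ n) (AZ n S) (AZ n T) (κ g) (κ h)
        ≡⟨ reindex (AZ n S) (AZ n T) (𝒫-cayleyMat S-symmetric) (𝒫-cayleyMat T-symmetric) g h ⟨
      matMul (enumD n) (AD n (𝒫 n S)) (AD n (𝒫 n T)) g h  ∎
      where
      open ≡-Reasoning
      reindex = matMul-reindex (enumD-unique n) ∈-enumD (Unique.allFin⁺ (2 * n)) ∈-allFin κ-bijective

module _ {k : ℕ} where
  private
    n = suc k

  even⇒double : (x : Z n) → toℕ x % 2 ≡ 0 → ∃[ y ] addZ n y y ≡ x
  even⇒double x x-even = y , toℕ-injective (begin
    toℕ (addZ n y y)             ≡⟨ toℕ-addMod y y ⟩
    (toℕ y + toℕ y) % (2 * n)    ≡⟨ cong (λ t → (t + t) % (2 * n)) (toℕ-fromℕ< y<2n) ⟩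
    (h + h) % (2 * n)            ≡⟨ cong (_% (2 * n)) h+h≡x ⟩
    toℕ x % (2 * n)              ≡⟨ m<n⇒m%n≡m (toℕ<n x) ⟩
    toℕ x                        ∎)
    where
    open ≡-Reasoning
    h = toℕ x / 2
    y<2n : h < 2 * n
    y<2n = ≤-<-trans (m/n≤m (toℕ x) 2) (toℕ<n x)
    y : Z n
    y = fromℕ< y<2n
    h+h≡x : h + h ≡ toℕ x
    h+h≡x = sym (begin
      toℕ x              ≡⟨ m≡m%n+[m/n]*n (toℕ x) 2 ⟩
      toℕ x % 2 + h * 2  ≡⟨ cong (_+ h * 2) x-even ⟩
      h * 2              ≡⟨ *-comm h 2 ⟩
      h + (h + 0)        ≡⟨ cong (h +_) (+-identityʳ h) ⟩
      h + h              ∎)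

  self-inverse⇒n : (w : Z n) → addZ n w w ≡ fzero → w ≢ fzero → toℕ w ≡ n
  self-inverse⇒n w w+w≡0 w≢0 = from-quotient q (m<n*o⇒m/o<n (*-monoʳ-< 2 (toℕ<n w))) 2a≡q*2n
    where
    open ≡-Reasoning
    a = toℕ w
    q = (2 * a) / (2 * n)
    2a≡q*2n : 2 * a ≡ q * (2 * n)
    2a≡q*2n = begin
      2 * a                            ≡⟨ m≡m%n+[m/n]*n (2 * a) (2 * n) ⟩
      (2 * a) % (2 * n) + q * (2 * n)  ≡⟨ cong (λ t → t % (2 * n) + q * (2 * n)) (cong (a +_) (+-identityʳ a)) ⟩
      (a + a) % (2 * n) + q * (2 * n)  ≡⟨ cong (_+ q * (2 * n)) (trans (sym (toℕ-addMod w w)) (cong toℕ w+w≡0)) ⟩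
      q * (2 * n)                      ∎
    from-quotient : ∀ q → q < 2 → 2 * a ≡ q * (2 * n) → a ≡ n
    from-quotient 0 _ 2a≡0  = contradiction (toℕ-injective (m+n≡0⇒m≡0 a 2a≡0)) w≢0
    from-quotient 1 _ 2a≡2n = *-cancelˡ-≡ a n 2 (trans 2a≡2n (*-identityˡ (2 * n)))
    from-quotient (suc (suc _)) (s≤s (s≤s ())) _

liftD : ∀ n → (Z n → Z n) → D n → D n
liftD n α = φ n ∘ α ∘ ψ n

module _ {k : ℕ} (n-odd : Odd (suc k)) {α : Z (suc k) → Z (suc k)} (α-aut : IsAut (addZ (suc k)) α) where
  private
    n = suc k
    f = liftD n α

    α-injective : Injective _≡_ _≡_ α
    α-injective = proj₁ (proj₁ α-aut)

    α-additive : Additive α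
    α-additive = proj₂ α-aut

  liftD-⊕ : ∀ a b → f (a ⊕ b) ≡ f a ⊕ f b
  liftD-⊕ a b = begin
    φ n (α (ψ n (a ⊕ b)))                  ≡⟨ cong (φ n ∘ α) (ψ-⊕ n-odd a b) ⟩
    φ n (α (addZ n (ψ n a) (ψ n b)))       ≡⟨ cong (φ n) (α-additive (ψ n a) (ψ n b)) ⟩
    φ n (addZ n (α (ψ n a)) (α (ψ n b)))   ≡⟨ φ-additive (α (ψ n a)) (α (ψ n b)) ⟩
    f a ⊕ f b                              ∎
    where open ≡-Reasoning

  -- α fixes n, the only element of order 2 in ℤ_{2n}
  liftD-reflection : ∀ i → f (i , fzero) ≡ (i , fzero)
  liftD-reflection fzero        = cong (φ n) (additive⇒zero-homo α α-additive)
  liftD-reflection (fsuc fzero) = cong₂ _,_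
    (toℕ-injective (trans (toℕ-reduce 1 w) (trans (cong (_% 2) w≡n) n-odd)))
    (toℕ-injective (trans (toℕ-reduce k w) (trans (cong (_% n) w≡n) (n%n≡0 n))))
    where
    s = ψ n (fsuc fzero , fzero)
    w = α s
    w+w≡0 : addZ n w w ≡ fzero
    w+w≡0 = begin
      addZ n w w         ≡⟨ α-additive s s ⟨
      α (addZ n s s)     ≡⟨ cong α (ψ-⊕ n-odd (fsuc fzero , fzero) (fsuc fzero , fzero)) ⟨
      α fzero            ≡⟨ additive⇒zero-homo α α-additive ⟩
      fzero              ∎
      where open ≡-Reasoning
    w≢0 : w ≢ fzero
    w≢0 w≡0 with cong toℕ (α-injective (trans w≡0 (sym (additive⇒zero-homo α α-additive))))
    ... | ()
    w≡n : toℕ w ≡ n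
    w≡n = self-inverse⇒n w w+w≡0 w≢0

  -- ψ (0 , j) is even, hence a double, so α maps it to an even element
  liftD-rotation-parity : ∀ j → proj₁ (f (fzero , j)) ≡ fzero
  liftD-rotation-parity j with even⇒double (ψ n (fzero , j)) r-even
    where
    r-even : toℕ (ψ n (fzero , j)) % 2 ≡ 0
    r-even = trans (sym (toℕ-reduce 1 (ψ n (fzero , j)))) (cong (toℕ ∘ proj₁) (φ∘ψ n-odd (fzero , j)))
  ... | y , y+y≡r = begin
    reduce 1 (α (ψ n (fzero , j)))               ≡⟨ cong (reduce 1 ∘ α) y+y≡r ⟨
    reduce 1 (α (addZ n y y))                    ≡⟨ cong (reduce 1) (α-additive y y) ⟩
    reduce 1 (addZ n (α y) (α y))                ≡⟨ reduce-additive (m∣m*n n) (α y) (α y) ⟩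
    addMod (reduce 1 (α y)) (reduce 1 (α y))     ≡⟨ addMod-self-Fin2 (reduce 1 (α y)) ⟩
    fzero                                        ∎
    where open ≡-Reasoning

  rotationPart : Fin n → Fin n
  rotationPart j = proj₂ (f (fzero , j))

  liftD-onRotations : ∀ d → f d ≡ onRotations rotationPart d
  liftD-onRotations (i , j) = begin
    f (i , j)                                 ≡⟨ cong f (cong₂ _,_ (addMod-identityʳ i) (addMod-identityˡ j)) ⟨
    f ((i , fzero) ⊕ (fzero , j))             ≡⟨ liftD-⊕ (i , fzero) (fzero , j) ⟩
    f (i , fzero) ⊕ f (fzero , j)
      ≡⟨ cong₂ _⊕_ (liftD-reflection i) (cong (_, rotationPart j) (liftD-rotation-parity j)) ⟩
    (i , fzero) ⊕ (fzero , rotationPart j)    ≡⟨ cong₂ _,_ (addMod-identityʳ i) (addMod-identityˡ (rotationPart j)) ⟩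
    (i , rotationPart j)                      ∎
    where open ≡-Reasoning

  rotationPart-additive : Additive rotationPart
  rotationPart-additive j l = cong proj₂ (liftD-⊕ (fzero , j) (fzero , l))

  liftD-isAut : IsAut (mulD n) f
  liftD-isAut = bijective , homo
    where
    bijective : Bijective _≡_ _≡_ f
    bijective = Composition.bijective _≡_ _≡_ _≡_
      (Composition.bijective _≡_ _≡_ _≡_ (ψ-bijective n-odd) (proj₁ α-aut)) (φ-bijective n-odd)
    homo : ∀ g h → f (mulD n g h) ≡ mulD n (f g) (f h)
    homo g h = begin
      f (mulD n g h)                                   ≡⟨ liftD-onRotations (mulD n g h) ⟩
      onRotations rotationPart (mulD n g h)            ≡⟨ onRotations-homo rotationPart-additive g h ⟩
      mulD n (onRotations rotationPart g) (onRotations rotationPart h)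
        ≡⟨ cong₂ (mulD n) (liftD-onRotations g) (liftD-onRotations h) ⟨
      mulD n (f g) (f h)                               ∎
      where open ≡-Reasoning

  𝒫-image : ∀ {A S} → (∀ x → A x ≡ imageZ n α S x) → ∀ d → 𝒫 n A d ≡ imageD n f (𝒫 n S) d
  𝒫-image {A} {S} A≡αS d with a , αa≡ψd ← proj₂ (proj₁ α-aut) (ψ n d) = begin
    𝒫 n A d                      ≡⟨ 𝒫-ψ n-odd A d ⟩
    A (ψ n d)                    ≡⟨ A≡αS (ψ n d) ⟩
    imageZ n α S (ψ n d)         ≡⟨ image-injective (enumZ n) _≟_ α-injective S (∈-allFin a) (αa≡ψd refl) ⟩
    S a                          ≡⟨ cong S (ψ∘φ n-odd a) ⟨
    S (ψ n (φ n a))              ≡⟨ 𝒫-ψ n-odd S (φ n a) ⟨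
    𝒫 n S (φ n a)
      ≡⟨ image-injective (enumD n) _≟D_ (proj₁ (proj₁ liftD-isAut)) (𝒫 n S) (∈-enumD (φ n a)) fφa≡d ⟨
    imageD n f (𝒫 n S) d         ∎
    where
    open ≡-Reasoning
    fφa≡d : f (φ n a) ≡ d
    fφa≡d = trans (cong (φ n ∘ α) (ψ∘φ n-odd a)) (trans (cong (φ n) (αa≡ψd refl)) (φ∘ψ n-odd d))

mainTheorem17 :
    (n : ℕ) → 3 ≤ n → Odd n →
    (S T U : Subset (Z n)) →
    AvoidsZeroZ n S → AvoidsZeroZ n T → AvoidsZeroZ n U →
    SymmetricZ n S → SymmetricZ n T → SymmetricZ n U →
    ProductRelZ n S T U →
    -- (1)
    ((AvoidsIdD n (𝒫 n S) × AvoidsIdD n (𝒫 n T) × AvoidsIdD n (𝒫 n U))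
      × (SymmetricD n (𝒫 n S) × SymmetricD n (𝒫 n T) × SymmetricD n (𝒫 n U))
      × ProductRelD n (𝒫 n S) (𝒫 n T) (𝒫 n U))
    -- (2)
    × (StronglySymmetricD n (𝒫 n S) × StronglySymmetricD n (𝒫 n T)
        × StronglySymmetricD n (𝒫 n U))
    -- moreover
    × ((A B C : Subset (Z n)) →
        AvoidsZeroZ n A → AvoidsZeroZ n B → AvoidsZeroZ n C →
        SymmetricZ n A → SymmetricZ n B → SymmetricZ n C →
        ProductRelZ n A B C →
        (α : Z n → Z n) → IsAut (addZ n) α →
        (∀ x → A x ≡ imageZ n α S x) →
        (∀ x → B x ≡ imageZ n α T x) →
        (∀ x → C x ≡ imageZ n α U x) →
        Σ (D n → D n) (λ f → IsAut (mulD n) f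
          × (∀ d → 𝒫 n A d ≡ imageD n f (𝒫 n S) d)
          × (∀ d → 𝒫 n B d ≡ imageD n f (𝒫 n T) d)
          × (∀ d → 𝒫 n C d ≡ imageD n f (𝒫 n U) d)))
mainTheorem17 zero ()
mainTheorem17 n@(suc _) _ n-odd S T U S-avoids T-avoids U-avoids S-sym T-sym U-sym U≡ST =
  ( (𝒫-avoidsId n-odd S-avoids , 𝒫-avoidsId n-odd T-avoids , 𝒫-avoidsId n-odd U-avoids)
  , (symmetric S-sym , symmetric T-sym , symmetric U-sym)
  , 𝒫-productRel n-odd S-sym T-sym U-sym U≡ST )
  , (strong S-sym , strong T-sym , strong U-sym)
  , λ { A B C _ _ _ _ _ _ _ α α-aut A≡αS B≡αT C≡αU →
        liftD n α , liftD-isAut n-odd α-aut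
      , 𝒫-image n-odd α-aut A≡αS , 𝒫-image n-odd α-aut B≡αT , 𝒫-image n-odd α-aut C≡αU }
  where
  strong : ∀ {X} → SymmetricZ n X → StronglySymmetricD n (𝒫 n X)
  strong = 𝒫-stronglySymmetric n-odd
  symmetric : ∀ {X} → SymmetricZ n X → SymmetricD n (𝒫 n X)
  symmetric = stronglySymmetric⇒symmetric ∘ strong
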